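{- Let $L$ be any of the fifteen logics of the modal cube and $\mathcal M_L$ its Nmatrix. For every $n\ge 0$ and every maximally consistent set $\Delta$ in $L$, the characteristic function $v^L_\Delta$ belongs to $L_n(\mathcal M_L)$.
   Context: Syntax and logics. Formulas: $\alpha ::= p \mid \bot \mid \alpha\to\alpha \mid \Box\alpha$; $\mathrm{For}$ is the set of formulas; $\neg\alpha:=\alpha\to\bot$, $\Diamond\alpha:=\neg\Box\neg\alpha$, $\wedge,\vee$ the usual classical abbreviations. $\mathbf K$: classical propositional axioms, (k) $\Box(\alpha\to\beta)\to(\Box\alpha\to\Box\beta)$, modus ponens, necessitation. Axiom schemes (D) $\Box\alpha\to\Diamond\alpha$, (T) $\Box\alpha\to\alpha$, (B) $\alpha\to\Box\Diamond\alpha$, (4) $\Box\alpha\to\Box\Box\alpha$, (5) $\Diamond\alpha\to\Box\Diamond\alpha$. The modal cube: $\mathbf K,\mathbf{KB},\mathbf{K4},\mathbf{K5},\mathbf{K45},\mathbf{KD},\mathbf{KDB},\mathbf{KD4},\mathbf{KD5},\mathbf{KD45},\mathbf{KT},\mathbf{KTB},\mathbf{S4}=\mathbf{KT4},\mathbf{S5}=\mathbf{KTB45},\mathbf{KB5}=\mathbf{KB45}$. $\Delta\vdash_L\alpha$ means $\alpha$ or $(\gamma_1\wedge\dots\wedge\gamma_k)\to\alpha$ (some $\gamma_i\in\Delta$) is a theorem of $L$. $\Delta$ is consistent if no $\alpha$ has $\Delta\vdash_L\alpha$ and $\Delta\vdash_L\neg\alpha$, and maximally consistent if moreover $\Delta\cup\{\beta\}$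 is inconsistent for each $\beta\notin\Delta$. Truth values and modal characterization: $\mathbf F(\alpha)=\Diamond\neg\alpha\wedge\neg\alpha\wedge\Box\neg\alpha$, $\mathbf f(\alpha)=\Diamond\neg\alpha\wedge\neg\alpha\wedge\Diamond\alpha$, $\mathbf f_2(\alpha)=\Box\alpha\wedge\neg\alpha\wedge\Box\neg\alpha$, $\mathbf f_3(\alpha)=\Box\alpha\wedge\neg\alpha\wedge\Diamond\alpha$, $\mathbf t_3(\alpha)=\Diamond\neg\alpha\wedge\alpha\wedge\Box\neg\alpha$, $\mathbf t_2(\alpha)=\Box\alpha\wedge\alpha\wedge\Box\neg\alpha$, $\mathbf t(\alpha)=\Diamond\neg\alpha\wedge\alpha\wedge\Diamond\alpha$, $\mathbf T(\alpha)=\Box\alpha\wedge\alpha\wedge\Diamond\alpha$. Designated set $\mathcal D=\{\mathbf T,\mathbf t,\mathbf t_2,\mathbf t_3\}$. Characteristic function: $v^L_\Delta:\mathrm{For}\to V(L)$, $v^L_\Delta(\alpha)=\iota$ iff $\Delta\vdash_L\iota(\alpha)$. Nmatrix $\mathcal M_L$. Values $V(L)$: all eight values for $\mathbf K,\mathbf{KB},\mathbf{K4},\mathbf{K5},\mathbf{K45}$; $\{\mathbf F,\mathbf f,\mathbf f_2,\mathbf t_2,\mathbf t,\mathbf T\}$ for $\mathbf{KB5}$; $\{\mathbf F,\mathbf f,\mathbf f_3,\mathbf t_3,\mathbf t,\mathbf T\}$ for $\mathbf{KD},\mathbf{KDB},\mathbf{KD4},\mathbf{KD5},\mathbf{KD45}$;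 $\{\mathbf F,\mathbf f,\mathbf t,\mathbf T\}$ for $\mathbf{KT},\mathbf{KTB},\mathbf{S4},\mathbf{S5}$. Designated values $V(L)\cap\mathcal D$. $\tilde\bot=\{\mathbf F,\mathbf f_2\}$. $\tilde\to(x,y)$, restricted to arguments in $V(L)$, listed for $y=\mathbf F,\mathbf f,\mathbf f_2,\mathbf f_3,\mathbf t_3,\mathbf t_2,\mathbf t,\mathbf T$: $x=\mathbf F$: $\{\mathbf T\}$ for all $y$; $x=\mathbf f$: $\{\mathbf t\},\{\mathbf T,\mathbf t\},\{\mathbf t_2\},\{\mathbf T\},\{\mathbf t\},\{\mathbf T\},\{\mathbf T,\mathbf t\},\{\mathbf T\}$; $x=\mathbf f_2$ and $x=\mathbf f_3$: $\{\mathbf t_3\},\{\mathbf t\},\{\mathbf t_2\},\{\mathbf T\},\{\mathbf t_3\},\{\mathbf t_2\},\{\mathbf t\},\{\mathbf T\}$; $x=\mathbf t_3$: $\{\mathbf f_3\}$ for $y\in\{\mathbf F,\mathbf f,\mathbf f_2,\mathbf f_3\}$, $\{\mathbf T\}$ otherwise; $x=\mathbf t_2$: $\{\mathbf F\},\{\mathbf f\},\{\mathbf f_2\},\{\mathbf f_3\},\{\mathbf t_3\},\{\mathbf t_2\},\{\mathbf t_3\},\{\mathbf T\}$; $x=\mathbf t$: $\{\mathbf f\},\{\mathbf f,\mathbf f_3\},\{\mathbf f_3\},\{\mathbf f_3\},\{\mathbf t\},\{\mathbf T\},\{\mathbf T,\mathbf t\},\{\mathbf T\}$; $x=\mathbf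 T$: $\{\mathbf F\},\{\mathbf f\},\{\mathbf f_2\},\{\mathbf f_3\},\{\mathbf t_3\},\{\mathbf t_2\},\{\mathbf t\},\{\mathbf T\}$. $\tilde\Box$ (argument $\mapsto$ output): $\mathbf K$: $\mathbf F,\mathbf f,\mathbf t_3,\mathbf t\mapsto\{\mathbf F,\mathbf f,\mathbf f_3\}$; $\mathbf f_2,\mathbf t_2\mapsto\{\mathbf t_2\}$; $\mathbf f_3,\mathbf T\mapsto\{\mathbf T,\mathbf t,\mathbf t_3\}$. $\mathbf{KB}$: $\mathbf F,\mathbf f\mapsto\{\mathbf F\}$; $\mathbf f_2,\mathbf t_2\mapsto\{\mathbf t_2\}$; $\mathbf f_3\mapsto\{\mathbf t_3\}$; $\mathbf t_3,\mathbf t\mapsto\{\mathbf F,\mathbf f,\mathbf f_3\}$; $\mathbf T\mapsto\{\mathbf T,\mathbf t,\mathbf t_3\}$. $\mathbf{K4}$: $\mathbf F,\mathbf f,\mathbf t_3,\mathbf t\mapsto\{\mathbf F,\mathbf f,\mathbf f_3\}$; $\mathbf f_2,\mathbf t_2\mapsto\{\mathbf t_2\}$; $\mathbf f_3,\mathbf T\mapsto\{\mathbf T\}$. $\mathbf{K5}$: $\mathbf F,\mathbf f,\mathbf t_3,\mathbf t\mapsto\{\mathbf F\}$; $\mathbf f_2,\mathbf t_2\mapsto\{\mathbf t_2\}$; $\mathbf f_3,\mathbf T\mapsto\{\mathbf T,\mathbf t_3\}$. $\mathbf{K45}$: $\mathbf F,\mathbf f,\mathbf t_3,\mathbf t\mapsto\{\mathbf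 F\}$; $\mathbf f_2,\mathbf t_2\mapsto\{\mathbf t_2\}$; $\mathbf f_3,\mathbf T\mapsto\{\mathbf T\}$. $\mathbf{KB5}$: $\mathbf F,\mathbf f,\mathbf t\mapsto\{\mathbf F\}$; $\mathbf f_2,\mathbf t_2\mapsto\{\mathbf t_2\}$; $\mathbf T\mapsto\{\mathbf T\}$. $\mathbf{KD}$: $\mathbf F,\mathbf f,\mathbf t_3,\mathbf t\mapsto\{\mathbf F,\mathbf f,\mathbf f_3\}$; $\mathbf f_3,\mathbf T\mapsto\{\mathbf T,\mathbf t,\mathbf t_3\}$. $\mathbf{KDB}$: $\mathbf F,\mathbf f\mapsto\{\mathbf F\}$; $\mathbf f_3\mapsto\{\mathbf t_3\}$; $\mathbf t_3,\mathbf t\mapsto\{\mathbf F,\mathbf f,\mathbf f_3\}$; $\mathbf T\mapsto\{\mathbf T,\mathbf t,\mathbf t_3\}$. $\mathbf{KD4}$: $\mathbf F,\mathbf t_3\mapsto\{\mathbf F\}$; $\mathbf f,\mathbf t\mapsto\{\mathbf F,\mathbf f,\mathbf f_3\}$; $\mathbf f_3,\mathbf T\mapsto\{\mathbf T\}$. $\mathbf{KD5}$: $\mathbf F,\mathbf f,\mathbf t_3,\mathbf t\mapsto\{\mathbf F\}$; $\mathbf f_3,\mathbf T\mapsto\{\mathbf T,\mathbf t_3\}$. $\mathbf{KD45}$: $\mathbf F,\mathbf f,\mathbf t_3,\mathbf t\mapsto\{\mathbf F\}$; $\mathbf f_3,\mathbf T\mapsto\{\mathbf T\}$. $\mathbf{KT}$: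 $\mathbf F\mapsto\{\mathbf F\}$; $\mathbf f,\mathbf t\mapsto\{\mathbf F,\mathbf f\}$; $\mathbf T\mapsto\{\mathbf T,\mathbf t\}$. $\mathbf{KTB}$: $\mathbf F,\mathbf f\mapsto\{\mathbf F\}$; $\mathbf t\mapsto\{\mathbf F,\mathbf f\}$; $\mathbf T\mapsto\{\mathbf T,\mathbf t\}$. $\mathbf{S4}$: $\mathbf F\mapsto\{\mathbf F\}$; $\mathbf f,\mathbf t\mapsto\{\mathbf F,\mathbf f\}$; $\mathbf T\mapsto\{\mathbf T\}$. $\mathbf{S5}$: $\mathbf F,\mathbf f,\mathbf t\mapsto\{\mathbf F\}$; $\mathbf T\mapsto\{\mathbf T\}$. A valuation in $\mathcal M_L$ is a map $v:\mathrm{For}\to V(L)$ with $v(\bot)\in\tilde\bot$, $v(\alpha\to\beta)\in\tilde\to(v(\alpha),v(\beta))$, $v(\Box\alpha)\in\tilde\Box(v(\alpha))$; $\mathrm{Val}(\mathcal M_L)$ is the set of valuations. Level valuations: $L_0(\mathcal M_L)$ is the set of $v\in\mathrm{Val}(\mathcal M_L)$ such that, if $v(\alpha)\in\{\mathbf f_2,\mathbf t_2\}$ for some $\alpha$, then $v(\beta)\in\{\mathbf f_2,\mathbf t_2\}$ for all $\beta$. $L_{n+1}(\mathcal M_L)=\{v\in L_n(\mathcal M_L)\mid$ for all $\alpha$, if $w(\alpha)\in\mathcal D$ for every $w\in L_n(\mathcal M_L)$, then $v(\alpha)\in\{\mathbf T,\mathbf t_2\}\}$. -}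

module Defs where

open import Data.Nat using (ℕ; zero; suc)
open import Data.List using (List; []; _∷_)
open import Data.List.Membership.Propositional using (_∈_)
open import Data.List.Relation.Unary.All using (All)
open import Data.Bool using (Bool; true; false; T)
open import Data.Product using (Σ; _×_; _,_)
open import Data.Sum using (_⊎_)
open import Relation.Nullary using (¬_)
open import Relation.Binary.PropositionalEquality using (_≡_)
open import Function.Bundles using (_⇔_)

infixr 20 _⇒_
data Form : Set where
  var : ℕ → Form
  ⊥'  : Form
  _⇒_ : Form → Form → Form
  □   : Form → Form

infix 30 ~_
~_ : Form → Form
~ α = α ⇒ ⊥'

◇ : Form → Form
◇ α = ~ □ (~ α)

infixr 25 _∧'_
_∧'_ : Form → Form → Form
α ∧' β = ~ (α ⇒ ~ β)

data Logic : Set where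
  K KB K4 K5 K45 KD KDB KD4 KD5 KD45 KT KTB S4 S5 KB5 : Logic

hasD hasT hasB has4 has5 : Logic → Bool
hasD KD = true
hasD KDB = true
hasD KD4 = true
hasD KD5 = true
hasD KD45 = true
hasD _ = false

hasT KT = true
hasT KTB = true
hasT S4 = true
hasT S5 = true
hasT _ = false

hasB KB = true
hasB KDB = true
hasB KTB = true
hasB S5 = true
hasB KB5 = true
hasB _ = false

has4 K4 = true
has4 K45 = true
has4 KD4 = true
has4 KD45 = true
has4 S4 = true
has4 S5 = true
has4 KB5 = true
has4 _ = false

has5 K5 = true
has5 K45 = true
has5 KD5 = true
has5 KD45 = true
has5 S5 = true
has5 KB5 = true
has5 _ = false

data Thm (L : Logic) : Form → Set where
  ax1 : ∀ α β → Thm L (α ⇒ (β ⇒ α))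
  ax2 : ∀ α β γ → Thm L ((α ⇒ (β ⇒ γ)) ⇒ ((α ⇒ β) ⇒ (α ⇒ γ)))
  ax3 : ∀ α → Thm L (~ ~ α ⇒ α)
  axK : ∀ α β → Thm L (□ (α ⇒ β) ⇒ (□ α ⇒ □ β))
  axD : T (hasD L) → ∀ α → Thm L (□ α ⇒ ◇ α)
  axT : T (hasT L) → ∀ α → Thm L (□ α ⇒ α)
  axB : T (hasB L) → ∀ α → Thm L (α ⇒ □ (◇ α))
  ax4 : T (has4 L) → ∀ α → Thm L (□ α ⇒ □ (□ α))
  ax5 : T (has5 L) → ∀ α → Thm L (◇ α ⇒ □ (◇ α))
  mp  : ∀ {α β} → Thm L (α ⇒ β) → Thm L α → Thm L β
  nec : ∀ {α} → Thm L α → Thm L (□ α)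

FSet : Set₁
FSet = Form → Set

conj : Form → List Form → Form
conj γ [] = γ
conj γ (δ ∷ δs) = γ ∧' conj δ δs

infix 5 _⊢[_]_
_⊢[_]_ : FSet → Logic → Form → Set
Δ ⊢[ L ] α = Thm L α ⊎ Σ Form λ γ → Σ (List Form) λ γs →
               All Δ (γ ∷ γs) × Thm L (conj γ γs ⇒ α)

Consistent : Logic → FSet → Set
Consistent L Δ = ¬ (Σ Form λ α → (Δ ⊢[ L ] α) × (Δ ⊢[ L ] ~ α))

MaxConsistent : Logic → FSet → Set
MaxConsistent L Δ = Consistent L Δ ×
  (∀ β → ¬ Δ β → ¬ Consistent L (λ φ → Δ φ ⊎ φ ≡ β))

data V8 : Set where
  vF vf vf2 vf3 vt3 vt2 vt vT : V8

ι : V8 → Form → Form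
ι vF  α = ◇ (~ α) ∧' (~ α ∧' □ (~ α))
ι vf  α = ◇ (~ α) ∧' (~ α ∧' ◇ α)
ι vf2 α = □ α ∧' (~ α ∧' □ (~ α))
ι vf3 α = □ α ∧' (~ α ∧' ◇ α)
ι vt3 α = ◇ (~ α) ∧' (α ∧' □ (~ α))
ι vt2 α = □ α ∧' (α ∧' □ (~ α))
ι vt  α = ◇ (~ α) ∧' (α ∧' ◇ α)
ι vT  α = □ α ∧' (α ∧' ◇ α)

designated : List V8
designated = vT ∷ vt ∷ vt2 ∷ vt3 ∷ []

IsCharacteristic : Logic → FSet → (Form → V8) → Set
IsCharacteristic L Δ v = ∀ α x → (v α ≡ x) ⇔ (Δ ⊢[ L ] ι x α)

values : Logic → List V8
values K    = vF ∷ vf ∷ vf2 ∷ vf3 ∷ vt3 ∷ vt2 ∷ vt ∷ vT ∷ []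
values KB   = vF ∷ vf ∷ vf2 ∷ vf3 ∷ vt3 ∷ vt2 ∷ vt ∷ vT ∷ []
values K4   = vF ∷ vf ∷ vf2 ∷ vf3 ∷ vt3 ∷ vt2 ∷ vt ∷ vT ∷ []
values K5   = vF ∷ vf ∷ vf2 ∷ vf3 ∷ vt3 ∷ vt2 ∷ vt ∷ vT ∷ []
values K45  = vF ∷ vf ∷ vf2 ∷ vf3 ∷ vt3 ∷ vt2 ∷ vt ∷ vT ∷ []
values KB5  = vF ∷ vf ∷ vf2 ∷ vt2 ∷ vt ∷ vT ∷ []
values KD   = vF ∷ vf ∷ vf3 ∷ vt3 ∷ vt ∷ vT ∷ []
values KDB  = vF ∷ vf ∷ vf3 ∷ vt3 ∷ vt ∷ vT ∷ []
values KD4  = vF ∷ vf ∷ vf3 ∷ vt3 ∷ vt ∷ vT ∷ []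
values KD5  = vF ∷ vf ∷ vf3 ∷ vt3 ∷ vt ∷ vT ∷ []
values KD45 = vF ∷ vf ∷ vf3 ∷ vt3 ∷ vt ∷ vT ∷ []
values KT   = vF ∷ vf ∷ vt ∷ vT ∷ []
values KTB  = vF ∷ vf ∷ vt ∷ vT ∷ []
values S4   = vF ∷ vf ∷ vt ∷ vT ∷ []
values S5   = vF ∷ vf ∷ vt ∷ vT ∷ []

botT : List V8
botT = vF ∷ vf2 ∷ []

impT : V8 → V8 → List V8
impT vF _ = vT ∷ []
impT vf vF  = vt ∷ []
impT vf vf  = vT ∷ vt ∷ []
impT vf vf2 = vt2 ∷ []
impT vf vf3 = vT ∷ []
impT vf vt3 = vt ∷ []
impT vf vt2 = vT ∷ []
impT vf vt  = vT ∷ vt ∷ []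
impT vf vT  = vT ∷ []
impT vf2 y = impT23 y
  where
  impT23 : V8 → List V8
  impT23 vF  = vt3 ∷ []
  impT23 vf  = vt ∷ []
  impT23 vf2 = vt2 ∷ []
  impT23 vf3 = vT ∷ []
  impT23 vt3 = vt3 ∷ []
  impT23 vt2 = vt2 ∷ []
  impT23 vt  = vt ∷ []
  impT23 vT  = vT ∷ []
impT vf3 vF  = vt3 ∷ []
impT vf3 vf  = vt ∷ []
impT vf3 vf2 = vt2 ∷ []
impT vf3 vf3 = vT ∷ []
impT vf3 vt3 = vt3 ∷ []
impT vf3 vt2 = vt2 ∷ []
impT vf3 vt  = vt ∷ []
impT vf3 vT  = vT ∷ []
impT vt3 vF  = vf3 ∷ []
impT vt3 vf  = vf3 ∷ []
impT vt3 vf2 = vf3 ∷ []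
impT vt3 vf3 = vf3 ∷ []
impT vt3 _   = vT ∷ []
impT vt2 vF  = vF ∷ []
impT vt2 vf  = vf ∷ []
impT vt2 vf2 = vf2 ∷ []
impT vt2 vf3 = vf3 ∷ []
impT vt2 vt3 = vt3 ∷ []
impT vt2 vt2 = vt2 ∷ []
impT vt2 vt  = vt3 ∷ []
impT vt2 vT  = vT ∷ []
impT vt vF  = vf ∷ []
impT vt vf  = vf ∷ vf3 ∷ []
impT vt vf2 = vf3 ∷ []
impT vt vf3 = vf3 ∷ []
impT vt vt3 = vt ∷ []
impT vt vt2 = vT ∷ []
impT vt vt  = vT ∷ vt ∷ []
impT vt vT  = vT ∷ []
impT vT y = y ∷ []

boxT : Logic → V8 → List V8
boxT K vF  = vF ∷ vf ∷ vf3 ∷ []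
boxT K vf  = vF ∷ vf ∷ vf3 ∷ []
boxT K vt3 = vF ∷ vf ∷ vf3 ∷ []
boxT K vt  = vF ∷ vf ∷ vf3 ∷ []
boxT K vf2 = vt2 ∷ []
boxT K vt2 = vt2 ∷ []
boxT K vf3 = vT ∷ vt ∷ vt3 ∷ []
boxT K vT  = vT ∷ vt ∷ vt3 ∷ []
boxT KB vF  = vF ∷ []
boxT KB vf  = vF ∷ []
boxT KB vf2 = vt2 ∷ []
boxT KB vt2 = vt2 ∷ []
boxT KB vf3 = vt3 ∷ []
boxT KB vt3 = vF ∷ vf ∷ vf3 ∷ []
boxT KB vt  = vF ∷ vf ∷ vf3 ∷ []
boxT KB vT  = vT ∷ vt ∷ vt3 ∷ []
boxT K4 vF  = vF ∷ vf ∷ vf3 ∷ []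
boxT K4 vf  = vF ∷ vf ∷ vf3 ∷ []
boxT K4 vt3 = vF ∷ vf ∷ vf3 ∷ []
boxT K4 vt  = vF ∷ vf ∷ vf3 ∷ []
boxT K4 vf2 = vt2 ∷ []
boxT K4 vt2 = vt2 ∷ []
boxT K4 vf3 = vT ∷ []
boxT K4 vT  = vT ∷ []
boxT K5 vF  = vF ∷ []
boxT K5 vf  = vF ∷ []
boxT K5 vt3 = vF ∷ []
boxT K5 vt  = vF ∷ []
boxT K5 vf2 = vt2 ∷ []
boxT K5 vt2 = vt2 ∷ []
boxT K5 vf3 = vT ∷ vt3 ∷ []
boxT K5 vT  = vT ∷ vt3 ∷ []
boxT K45 vF  = vF ∷ []
boxT K45 vf  = vF ∷ []
boxT K45 vt3 = vF ∷ []
boxT K45 vt  = vF ∷ []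
boxT K45 vf2 = vt2 ∷ []
boxT K45 vt2 = vt2 ∷ []
boxT K45 vf3 = vT ∷ []
boxT K45 vT  = vT ∷ []
boxT KB5 vF  = vF ∷ []
boxT KB5 vf  = vF ∷ []
boxT KB5 vt  = vF ∷ []
boxT KB5 vf2 = vt2 ∷ []
boxT KB5 vt2 = vt2 ∷ []
boxT KB5 vT  = vT ∷ []
boxT KB5 _   = []          -- arguments outside V(KB5)
boxT KD vF  = vF ∷ vf ∷ vf3 ∷ []
boxT KD vf  = vF ∷ vf ∷ vf3 ∷ []
boxT KD vt3 = vF ∷ vf ∷ vf3 ∷ []
boxT KD vt  = vF ∷ vf ∷ vf3 ∷ []
boxT KD vf3 = vT ∷ vt ∷ vt3 ∷ []
boxT KD vT  = vT ∷ vt ∷ vt3 ∷ []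
boxT KD _   = []           -- arguments outside V(KD)
boxT KDB vF  = vF ∷ []
boxT KDB vf  = vF ∷ []
boxT KDB vf3 = vt3 ∷ []
boxT KDB vt3 = vF ∷ vf ∷ vf3 ∷ []
boxT KDB vt  = vF ∷ vf ∷ vf3 ∷ []
boxT KDB vT  = vT ∷ vt ∷ vt3 ∷ []
boxT KDB _   = []
boxT KD4 vF  = vF ∷ []
boxT KD4 vt3 = vF ∷ []
boxT KD4 vf  = vF ∷ vf ∷ vf3 ∷ []
boxT KD4 vt  = vF ∷ vf ∷ vf3 ∷ []
boxT KD4 vf3 = vT ∷ []
boxT KD4 vT  = vT ∷ []
boxT KD4 _   = []
boxT KD5 vF  = vF ∷ []
boxT KD5 vf  = vF ∷ []
boxT KD5 vt3 = vF ∷ []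
boxT KD5 vt  = vF ∷ []
boxT KD5 vf3 = vT ∷ vt3 ∷ []
boxT KD5 vT  = vT ∷ vt3 ∷ []
boxT KD5 _   = []
boxT KD45 vF  = vF ∷ []
boxT KD45 vf  = vF ∷ []
boxT KD45 vt3 = vF ∷ []
boxT KD45 vt  = vF ∷ []
boxT KD45 vf3 = vT ∷ []
boxT KD45 vT  = vT ∷ []
boxT KD45 _   = []
boxT KT vF = vF ∷ []
boxT KT vf = vF ∷ vf ∷ []
boxT KT vt = vF ∷ vf ∷ []
boxT KT vT = vT ∷ vt ∷ []
boxT KT _  = []
boxT KTB vF = vF ∷ []
boxT KTB vf = vF ∷ []
boxT KTB vt = vF ∷ vf ∷ []
boxT KTB vT = vT ∷ vt ∷ []
boxT KTB _  = []
boxT S4 vF = vF ∷ []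
boxT S4 vf = vF ∷ vf ∷ []
boxT S4 vt = vF ∷ vf ∷ []
boxT S4 vT = vT ∷ []
boxT S4 _  = []
boxT S5 vF = vF ∷ []
boxT S5 vf = vF ∷ []
boxT S5 vt = vF ∷ []
boxT S5 vT = vT ∷ []
boxT S5 _  = []

Valuation : Logic → (Form → V8) → Set
Valuation L v =
  (∀ α → v α ∈ values L) ×
  (v ⊥' ∈ botT) ×
  (∀ α β → v (α ⇒ β) ∈ impT (v α) (v β)) ×
  (∀ α → v (□ α) ∈ boxT L (v α))

InLevel : Logic → ℕ → (Form → V8) → Set
InLevel L zero v = Valuation L v ×
  (∀ α → v α ∈ (vf2 ∷ vt2 ∷ []) → ∀ β → v β ∈ (vf2 ∷ vt2 ∷ []))
InLevel L (suc n) v = InLevel L n v ×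
  (∀ α → (∀ w → InLevel L n w → w α ∈ designated) → v α ∈ (vT ∷ vt2 ∷ []))

-- The characteristic function v_Δ of a maximal consistent set Δ gives α the value fixed by which
-- of □α, α and □¬α are derivable from Δ.  Maximal consistent sets satisfy a few derivable
-- constraints between such bits: □ is closed under consequence, □⊥ yields every □φ, → is
-- classical, and the instances of D, T, B, 4, 5 present in L hold.  An exhaustive check over all
-- bit patterns shows that these constraints keep the values inside the tables of M_L, so v_Δ is
-- a valuation; it lies in L₀ because □α and □¬α together derive □⊥.  For the higher levels, a
-- formula designated by every valuation in L_n is designated by v_Γ for every maximal consistent
-- Γ, hence is a theorem by Lindenbaum's lemma; so Δ derives both α and □α, giving v_Δ(α) ∈ {T, t₂}.

module Submission where

open import Defs
open import Axiom.ExcludedMiddle using (ExcludedMiddle)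
open import Level using (0ℓ)
open import Data.Bool using (Bool; true; false; T; not; _∧_; _∨_; if_then_else_)
import Data.Bool.Properties as Bool
open import Data.Nat using (ℕ; zero; suc; _≤_; _≤′_; ≤′-refl; ≤′-step; _⊔_)
open import Data.Nat.Properties using (≤⇒≤′; m≤m⊔n; m≤n⊔m)
open import Data.Product using (Σ; ∃-syntax; _×_; _,_; proj₁; proj₂; uncurry)
open import Data.Product.Properties using (≡-dec)
open import Data.Product.Function.NonDependent.Propositional using (_×-⇔_)
open import Data.Sum using (_⊎_; inj₁; inj₂; [_,_])
open import Data.List using (List; []; _∷_; _++_; map; foldl; cartesianProductWith)
open import Data.List.Membership.Propositional using (_∈_)
open import Data.List.Membership.Propositional.Properties
  using (∈-map⁺; ∈-cartesianProductWith⁺; ∈-++⁺ˡ; ∈-++⁺ʳ)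
open import Data.List.Relation.Unary.Any using (here; there)
open import Data.List.Relation.Unary.All as All using (All; []; _∷_; all?)
open import Data.List.Relation.Unary.All.Properties using (++⁺)
open import Data.List.Relation.Binary.Subset.Propositional using (_⊆_)
open import Data.List.Relation.Binary.Subset.Propositional.Properties
  using (xs⊆x∷xs; xs⊆xs++ys; xs⊆ys++xs; ∷⁺ʳ)
open import Data.Vec using (Vec; []; _∷_)
open import Function using (_∘_; id; _⇔_; mk⇔; Equivalence)
open import Function.Properties.Equivalence
  using (⇔-setoid) renaming (trans to ⇔-trans; sym to ⇔-sym)
open import Relation.Binary.Definitions using (DecidableEquality)
open import Relation.Binary.PropositionalEquality using (_≡_; refl; sym; trans; cong)
open import Relation.Nullary using (¬_; Dec; yes; no; does; proof)
open import Relation.Nullary.Reflects using (invert; of; det)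
open import Relation.Nullary.Decidable
  using (map′; _×-dec_; _→-dec_; ¬?; T?; From-yes; from-yes; dec-true; dec-false; decidable-stable)
open import Relation.Nullary.Negation using (contradiction)
open import Relation.Unary as Pred using (∅)

open Equivalence using (to; from)

variable
  A : Set
  a b c : Bool
  k k′ : ℕ
  φ ψ χ α β : Form
  φs Γ Θ hs : List Form
  Δ Δ′ : FSet
  x : V8

increasing⇒monotone : (P : ℕ → A → Set) → (∀ {k y} → P k y → P (suc k) y) →
                      k ≤ k′ → ∀ {y} → P k y → P k′ y
increasing⇒monotone P step = go ∘ ≤⇒≤′
  where
  go : k ≤′ k′ → ∀ {y} → P k y → P k′ y
  go ≤′-refl      = id
  go (≤′-step le) = step ∘ go le

does≡⇔ : (a? : Dec A) → does a? ≡ b ⇔ (if b then A else ¬ A)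
does≡⇔ a? = mk⇔ (λ { refl → invert (proof a?) }) (λ r → det (proof a?) (of r))

-- Phrased with does rather than isYes (cf. fromWitness), which computes through _×-dec_ and _→-dec_.
T-does : (a? : Dec A) → A → T (does a?)
T-does a? = Bool.T-≡ .from ∘ dec-true a?

module Deduction (L : Logic) where

  infix  4 _⊩_ _⊢_
  infixl 8 _·_
  infixr 5 ƛ_
  infixl 6 _∪｛_｝

  data _⊩_ (Γ : List Form) : Form → Set where
    hyp : φ ∈ Γ → Γ ⊩ φ
    thm : Thm L φ → Γ ⊩ φ
    _·_ : Γ ⊩ φ ⇒ ψ → Γ ⊩ φ → Γ ⊩ ψ

  #0 : φ ∷ Γ ⊩ φ
  #0 = hyp (here refl)

  #1 : ψ ∷ φ ∷ Γ ⊩ φ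
  #1 = hyp (there (here refl))

  #2 : χ ∷ ψ ∷ φ ∷ Γ ⊩ φ
  #2 = hyp (there (there (here refl)))

  substitute : (∀ {ψ} → ψ ∈ Θ → Γ ⊩ ψ) → Θ ⊩ φ → Γ ⊩ φ
  substitute σ (hyp m) = σ m
  substitute σ (thm t) = thm t
  substitute σ (d · e) = substitute σ d · substitute σ e

  weaken : Θ ⊆ Γ → Θ ⊩ φ → Γ ⊩ φ
  weaken s = substitute (λ m → hyp (s m))

  ⇒-refl : Thm L (φ ⇒ φ)
  ⇒-refl {φ} = mp (mp (ax2 φ (φ ⇒ φ) φ) (ax1 φ (φ ⇒ φ))) (ax1 φ φ)

  ƛ_ : φ ∷ Γ ⊩ ψ → Γ ⊩ φ ⇒ ψ
  ƛ hyp (here refl) = thm ⇒-refl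
  ƛ hyp (there m)   = thm (ax1 _ _) · hyp m
  ƛ thm t           = thm (ax1 _ _) · thm t
  ƛ (d · e)         = thm (ax2 _ _ _) · (ƛ d) · (ƛ e)

  theorem : [] ⊩ φ → Thm L φ
  theorem (hyp ())
  theorem (thm t) = t
  theorem (d · e) = mp (theorem d) (theorem e)

  dne : Γ ⊩ ~ ~ φ → Γ ⊩ φ
  dne d = thm (ax3 _) · d

  by-contradiction : ~ φ ∷ Γ ⊩ ⊥' → Γ ⊩ φ
  by-contradiction d = dne (ƛ d)

  efq : Γ ⊩ ⊥' → Γ ⊩ φ
  efq d = by-contradiction (weaken there d)

  ∧-intro : Γ ⊩ φ → Γ ⊩ ψ → Γ ⊩ φ ∧' ψ
  ∧-intro d e = ƛ (#0 · weaken there d · weaken there e)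

  ∧-elimˡ : Γ ⊩ φ ∧' ψ → Γ ⊩ φ
  ∧-elimˡ d = by-contradiction (weaken there d · (ƛ efq (#1 · #0)))

  ∧-elimʳ : Γ ⊩ φ ∧' ψ → Γ ⊩ ψ
  ∧-elimʳ d = by-contradiction (weaken there d · (ƛ #1))

  conj-intro : ∀ γ γs → γ ∷ γs ⊩ conj γ γs
  conj-intro γ []       = #0
  conj-intro γ (δ ∷ δs) = ∧-intro #0 (weaken there (conj-intro δ δs))

  conj-elim : ∀ γ γs → ψ ∈ γ ∷ γs → conj γ γs ∷ [] ⊩ ψ
  conj-elim γ []       (here refl) = #0
  conj-elim γ (δ ∷ δs) (here refl) = ∧-elimˡ #0
  conj-elim γ (δ ∷ δs) (there m)   =
    substitute (λ { (here refl) → ∧-elimʳ #0 }) (conj-elim δ δs m)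

  □-map₁ : φ ∷ [] ⊩ ψ → Γ ⊩ □ φ → Γ ⊩ □ ψ
  □-map₁ d p = thm (axK _ _) · thm (nec (theorem (ƛ d))) · p

  □-map₂ : φ ∷ ψ ∷ [] ⊩ χ → Γ ⊩ □ φ → Γ ⊩ □ ψ → Γ ⊩ □ χ
  □-map₂ d p q = thm (axK _ _) · □-map₁ (ƛ d) q · p

  ◇~⇒~□ : Thm L (◇ (~ φ) ⇒ ~ □ φ)
  ◇~⇒~□ = theorem (ƛ ƛ (#1 · □-map₁ (ƛ (#0 · #1)) #0))

  ~□⇒◇~ : Thm L (~ □ φ ⇒ ◇ (~ φ))
  ~□⇒◇~ = theorem (ƛ ƛ (#1 · □-map₁ (dne #0) #0))

  □~⇒~□ : T (hasD L) → Thm L (□ (~ φ) ⇒ ~ □ φ)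
  □~⇒~□ d = theorem (ƛ (thm ◇~⇒~□ · (thm (axD d _) · #0)))

  ~□⇒□~□ : T (has5 L) → Thm L (~ □ φ ⇒ □ (~ □ φ))
  ~□⇒□~□ f = theorem (ƛ □-map₁ (thm ◇~⇒~□ · #0) (thm (ax5 f _) · (thm ~□⇒◇~ · #0)))

  -- Hypotheses are kept as a list rather than a conjunction, so derivations compose (cf. ⊢⇔⊢[]).
  _⊢_ : FSet → Form → Set
  Δ ⊢ φ = Σ (List Form) λ hs → All Δ hs × hs ⊩ φ

  _∪｛_｝ : FSet → Form → FSet
  (Δ ∪｛ φ ｝) ψ = Δ ψ ⊎ ψ ≡ φ

  ⊢-theorem : Thm L φ → Δ ⊢ φ
  ⊢-theorem t = [] , [] , thm t

  ⊢-member : Δ φ → Δ ⊢ φ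
  ⊢-member p = _ ∷ [] , p ∷ [] , #0

  ⊢-mp : Δ ⊢ φ ⇒ ψ → Δ ⊢ φ → Δ ⊢ ψ
  ⊢-mp (hs , ps , d) (hs′ , ps′ , e) =
    hs ++ hs′ , ++⁺ ps ps′ , weaken (xs⊆xs++ys hs hs′) d · weaken (xs⊆ys++xs hs′ hs) e

  ⊢-map : Γ ⊩ φ → All (Δ ⊢_) Γ → Δ ⊢ φ
  ⊢-map d []       = ⊢-theorem (theorem d)
  ⊢-map d (p ∷ ps) = ⊢-mp (⊢-map (ƛ d) ps) p

  ⊢-mono : Δ Pred.⊆ Δ′ → Δ ⊢ φ → Δ′ ⊢ φ
  ⊢-mono s (hs , ps , d) = hs , All.map s ps , d

  ⊢-□map₁ : φ ∷ [] ⊩ ψ → Δ ⊢ □ φ → Δ ⊢ □ ψ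
  ⊢-□map₁ d p = ⊢-map (□-map₁ d #0) (p ∷ [])

  ⊢-□map₂ : φ ∷ ψ ∷ [] ⊩ χ → Δ ⊢ □ φ → Δ ⊢ □ ψ → Δ ⊢ □ χ
  ⊢-□map₂ d p q = ⊢-map (□-map₂ d #0 #1) (p ∷ q ∷ [])

  ⊢-∧ : Δ ⊢ φ ∧' ψ ⇔ (Δ ⊢ φ × Δ ⊢ ψ)
  ⊢-∧ = mk⇔ (λ p → ⊢-map (∧-elimˡ #0) (p ∷ []) , ⊢-map (∧-elimʳ #0) (p ∷ []))
            (λ (p , q) → ⊢-map (∧-intro #0 #1) (p ∷ q ∷ []))

  ⊢-deduction : Δ ∪｛ φ ｝ ⊢ ψ → Δ ⊢ φ ⇒ ψ
  ⊢-deduction (hs , ps , d) = let hs′ , ps′ , s = split ps in hs′ , ps′ , ƛ weaken s d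
    where
    split : ∀ {ys} → All (Δ ∪｛ φ ｝) ys → Σ (List Form) λ hs′ → All Δ hs′ × ys ⊆ φ ∷ hs′
    split []               = [] , [] , λ ()
    split (inj₁ p ∷ ps)    = let hs′ , ps′ , s = split ps in
      _ ∷ hs′ , p ∷ ps′ , λ { (here refl) → there (here refl)
                            ; (there m)   → ∷⁺ʳ _ (xs⊆x∷xs _ _) (s m) }
    split (inj₂ refl ∷ ps) = let hs′ , ps′ , s = split ps in
      hs′ , ps′ , λ { (here refl) → here refl ; (there m) → s m }

  ∅-⊢ : ∅ ⊢ φ → Thm L φ
  ∅-⊢ ([]    , []    , d) = theorem d
  ∅-⊢ (_ ∷ _ , () ∷ _ , _)

  ⊢⇔⊢[] : Δ ⊢ φ ⇔ Δ ⊢[ L ] φ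
  ⊢⇔⊢[] = mk⇔
    (λ { ([] , [] , d)      → inj₁ (theorem d)
       ; (γ ∷ γs , ps , d) → inj₂ (γ , γs , ps , theorem (ƛ substitute (conj-elim γ γs) d)) })
    (λ { (inj₁ t)                 → ⊢-theorem t
       ; (inj₂ (γ , γs , ps , t)) → γ ∷ γs , ps , thm t · conj-intro γ γs })

  consistent⇔⊬⊥ : Consistent L Δ ⇔ (¬ Δ ⊢ ⊥')
  consistent⇔⊬⊥ = mk⇔
    (λ cons ⊢⊥ → cons (⊥' , ⊢⇔⊢[] .to ⊢⊥ , ⊢⇔⊢[] .to (⊢-theorem ⇒-refl)))
    (λ ⊬⊥ → λ { (_ , p , q) → ⊬⊥ (⊢-mp (⊢⇔⊢[] .from q) (⊢⇔⊢[] .from p)) })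

  ⊢-middle : Δ ⊢ φ ∧' ψ ∧' χ → Δ ⊢ ψ
  ⊢-middle p = ⊢-map (∧-elimˡ (∧-elimʳ #0)) (p ∷ [])

  ⊢-ι-designated : x ∈ designated → Δ ⊢ ι x α → Δ ⊢ α
  ⊢-ι-designated (here refl)                         = ⊢-middle
  ⊢-ι-designated (there (here refl))                 = ⊢-middle
  ⊢-ι-designated (there (there (here refl)))         = ⊢-middle
  ⊢-ι-designated (there (there (there (here refl)))) = ⊢-middle

  ⊢-□∧□~⇒□⊥ : Δ ⊢ □ φ ∧' ψ ∧' □ (~ φ) → Δ ⊢ □ ⊥'
  ⊢-□∧□~⇒□⊥ p = ⊢-map (□-map₂ (#1 · #0) (∧-elimˡ #0) (∧-elimʳ (∧-elimʳ #0))) (p ∷ [])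

  ⊢-ι-f2t2 : x ∈ (vf2 ∷ vt2 ∷ []) → Δ ⊢ ι x α → Δ ⊢ □ ⊥'
  ⊢-ι-f2t2 (here refl)         = ⊢-□∧□~⇒□⊥
  ⊢-ι-f2t2 (there (here refl)) = ⊢-□∧□~⇒□⊥

module MaximalConsistent
  (em : ExcludedMiddle 0ℓ) (L : Logic) {Δ : FSet} (mc : MaxConsistent L Δ) where
  open Deduction L

  ⊬⊥ : ¬ Δ ⊢ ⊥'
  ⊬⊥ = consistent⇔⊬⊥ .to (proj₁ mc)

  ⊢-or-⊢~ : ∀ φ → Δ ⊢ φ ⊎ Δ ⊢ ~ φ
  ⊢-or-⊢~ φ with em {Δ φ}
  ... | yes φ∈Δ = inj₁ (⊢-member φ∈Δ)
  ... | no φ∉Δ  = inj₂ (⊢-deduction (decidable-stable em (proj₂ mc φ φ∉Δ ∘ consistent⇔⊬⊥ .from)))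

  ⊢~⇔⊬ : Δ ⊢ ~ φ ⇔ (¬ Δ ⊢ φ)
  ⊢~⇔⊬ {φ} = mk⇔ (λ p q → ⊬⊥ (⊢-mp p q)) (λ ⊬φ → [ (λ p → contradiction p ⊬φ) , id ] (⊢-or-⊢~ φ))

  ◇~⇔⊬□ : Δ ⊢ ◇ (~ φ) ⇔ (¬ Δ ⊢ □ φ)
  ◇~⇔⊬□ = ⇔-trans (mk⇔ (⊢-mp (⊢-theorem ◇~⇒~□)) (⊢-mp (⊢-theorem ~□⇒◇~))) ⊢~⇔⊬

module Lindenbaum (em : ExcludedMiddle 0ℓ) (L : Logic) where
  open Deduction L

  formulas : ℕ → List Form
  formulas zero    = ⊥' ∷ var zero ∷ []
  formulas (suc k) = formulas k ++ var (suc k) ∷ map □ (formulas k)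
                  ++ cartesianProductWith _⇒_ (formulas k) (formulas k)

  formulas-mono : k ≤ k′ → formulas k ⊆ formulas k′
  formulas-mono = increasing⇒monotone (λ k φ → φ ∈ formulas k) ∈-++⁺ˡ

  formulas-complete : ∀ φ → ∃[ k ] φ ∈ formulas k
  formulas-complete (var zero)    = zero , there (here refl)
  formulas-complete (var (suc n)) = suc n , ∈-++⁺ʳ (formulas n) (here refl)
  formulas-complete ⊥'            = zero , here refl
  formulas-complete (□ φ)         = let k , m = formulas-complete φ in
    suc k , ∈-++⁺ʳ (formulas k) (there (∈-++⁺ˡ (∈-map⁺ □ m)))
  formulas-complete (φ ⇒ ψ)       =
    let k , m = formulas-complete φ ; k′ , m′ = formulas-complete ψ in
    suc (k ⊔ k′) , ∈-++⁺ʳ (formulas (k ⊔ k′)) (there (∈-++⁺ʳ (map □ (formulas (k ⊔ k′)))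
      (∈-cartesianProductWith⁺ _⇒_ (formulas-mono (m≤m⊔n k k′) m) (formulas-mono (m≤n⊔m k k′) m′))))

  infixl 6 _⊕_
  _⊕_ : FSet → Form → FSet
  (Δ ⊕ φ) ψ = Δ ψ ⊎ (ψ ≡ φ × ¬ Δ ∪｛ φ ｝ ⊢ ⊥')

  ⊕-consistent : ¬ Δ ⊢ ⊥' → ¬ Δ ⊕ φ ⊢ ⊥'
  ⊕-consistent {Δ = Δ} {φ = φ} ⊬⊥ with em {Δ ∪｛ φ ｝ ⊢ ⊥'}
  ... | yes ⊢⊥ = ⊬⊥ ∘ ⊢-mono λ { (inj₁ p) → p ; (inj₂ (_ , ⊬⊥′)) → contradiction ⊢⊥ ⊬⊥′ }
  ... | no ⊬⊥′ = ⊬⊥′ ∘ ⊢-mono λ { (inj₁ p) → inj₁ p ; (inj₂ (refl , _)) → inj₂ refl }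

  foldl-⊕-consistent : ∀ φs → ¬ Δ ⊢ ⊥' → ¬ foldl _⊕_ Δ φs ⊢ ⊥'
  foldl-⊕-consistent []       = id
  foldl-⊕-consistent (φ ∷ φs) = foldl-⊕-consistent φs ∘ ⊕-consistent

  foldl-⊕-⊇ : ∀ φs → Δ Pred.⊆ foldl _⊕_ Δ φs
  foldl-⊕-⊇ []       = id
  foldl-⊕-⊇ (φ ∷ φs) = foldl-⊕-⊇ φs ∘ inj₁

  foldl-⊕-decides : φ ∈ φs → foldl _⊕_ Δ φs φ ⊎ foldl _⊕_ Δ φs ∪｛ φ ｝ ⊢ ⊥'
  foldl-⊕-decides {φs = ψ ∷ ψs} {Δ = Δ} (here refl) with em {Δ ∪｛ ψ ｝ ⊢ ⊥'}
  ... | yes ⊢⊥ = inj₂ (⊢-mono [ inj₁ ∘ foldl-⊕-⊇ ψs ∘ inj₁ , inj₂ ] ⊢⊥)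
  ... | no ⊬⊥  = inj₁ (foldl-⊕-⊇ ψs (inj₂ (refl , ⊬⊥)))
  foldl-⊕-decides {φs = _ ∷ _} (there m) = foldl-⊕-decides m

  stage : FSet → ℕ → FSet
  stage Δ zero    = Δ
  stage Δ (suc k) = foldl _⊕_ (stage Δ k) (formulas k)

  limit : FSet → FSet
  limit Δ φ = ∃[ k ] stage Δ k φ

  stage-consistent : ¬ Δ ⊢ ⊥' → ∀ k → ¬ stage Δ k ⊢ ⊥'
  stage-consistent ⊬⊥ zero    = ⊬⊥
  stage-consistent ⊬⊥ (suc k) = foldl-⊕-consistent (formulas k) (stage-consistent ⊬⊥ k)

  stage-mono : k ≤ k′ → stage Δ k Pred.⊆ stage Δ k′
  stage-mono {Δ = Δ} = increasing⇒monotone (stage Δ) (λ {k} → foldl-⊕-⊇ (formulas k))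

  limit-compact : All (limit Δ) hs → ∃[ k ] All (stage Δ k) hs
  limit-compact []             = zero , []
  limit-compact ((k , p) ∷ ps) = let k′ , ps′ = limit-compact ps in
    k ⊔ k′ , stage-mono (m≤m⊔n k k′) p ∷ All.map (stage-mono (m≤n⊔m k k′)) ps′

  limit-consistent : ¬ Δ ⊢ ⊥' → ¬ limit Δ ⊢ ⊥'
  limit-consistent ⊬⊥ (hs , ps , d) = let k , ps′ = limit-compact ps in
    stage-consistent ⊬⊥ k (hs , ps′ , d)

  limit-maximal : ¬ Δ ⊢ ⊥' → MaxConsistent L (limit Δ)
  limit-maximal {Δ = Δ} ⊬⊥ =
    consistent⇔⊬⊥ .from (limit-consistent ⊬⊥) ,
    λ β β∉ cons → consistent⇔⊬⊥ .to cons (∪-inconsistent β β∉)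
    where
    ∪-inconsistent : ∀ β → ¬ limit Δ β → limit Δ ∪｛ β ｝ ⊢ ⊥'
    ∪-inconsistent β β∉ with formulas-complete β
    ... | k , m with foldl-⊕-decides {Δ = stage Δ k} m
    ...   | inj₁ β∈ = contradiction (suc k , β∈) β∉
    ...   | inj₂ ⊢⊥ = ⊢-mono [ inj₁ ∘ (suc k ,_) , inj₂ ] ⊢⊥

  lindenbaum : ¬ Thm L α → Σ FSet λ Δ → MaxConsistent L Δ × Δ ⊢ ~ α
  lindenbaum {α} ⊬α = limit Δ₀ , limit-maximal Δ₀-consistent , ⊢-member (zero , inj₂ refl)
    where
    Δ₀ : FSet
    Δ₀ = ∅ ∪｛ ~ α ｝
    Δ₀-consistent : ¬ Δ₀ ⊢ ⊥'
    Δ₀-consistent = ⊬α ∘ mp (ax3 α) ∘ ∅-⊢ ∘ ⊢-deduction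

-- A truth value x is coded by which of □α, α, □¬α the formula ι x α asserts (see ι-select).
Bits : Set
Bits = Bool × Bool × Bool

fromBits : Bits → V8
fromBits (false , false , true ) = vF
fromBits (false , false , false) = vf
fromBits (true  , false , true ) = vf2
fromBits (true  , false , false) = vf3
fromBits (false , true  , true ) = vt3
fromBits (true  , true  , true ) = vt2
fromBits (false , true  , false) = vt
fromBits (true  , true  , false) = vT

toBits : V8 → Bits
toBits vF  = false , false , true
toBits vf  = false , false , false
toBits vf2 = true  , false , true
toBits vf3 = true  , false , false
toBits vt3 = false , true  , true
toBits vt2 = true  , true  , true
toBits vt  = false , true  , false
toBits vT  = true  , true  , false

fromBits-toBits : ∀ x → fromBits (toBits x) ≡ x
fromBits-toBits vF  = refl
fromBits-toBits vf  = refl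
fromBits-toBits vf2 = refl
fromBits-toBits vf3 = refl
fromBits-toBits vt3 = refl
fromBits-toBits vt2 = refl
fromBits-toBits vt  = refl
fromBits-toBits vT  = refl

toBits-fromBits : ∀ bs → toBits (fromBits bs) ≡ bs
toBits-fromBits (false , false , true ) = refl
toBits-fromBits (false , false , false) = refl
toBits-fromBits (true  , false , true ) = refl
toBits-fromBits (true  , false , false) = refl
toBits-fromBits (false , true  , true ) = refl
toBits-fromBits (true  , true  , true ) = refl
toBits-fromBits (false , true  , false) = refl
toBits-fromBits (true  , true  , false) = refl

fromBits≡⇔ : ∀ {bs} → fromBits bs ≡ x ⇔ bs ≡ toBits x
fromBits≡⇔ {x} {bs} = mk⇔ (λ e → trans (sym (toBits-fromBits bs)) (cong toBits e))
                         (λ e → trans (cong fromBits e) (fromBits-toBits x))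

_≟V8_ : DecidableEquality V8
x ≟V8 y = map′ (λ e → trans (sym (fromBits-toBits x)) (fromBits≡⇔ .from e)) (cong toBits)
               (≡-dec Bool._≟_ (≡-dec Bool._≟_ Bool._≟_) (toBits x) (toBits y))

open import Data.List.Membership.DecPropositional _≟V8_ using (_∈?_)

select : Bits → Form → Form
select (s , t , u) α =
  (if s then □ α else ◇ (~ α)) ∧' (if t then α else ~ α) ∧' (if u then □ (~ α) else ◇ α)

ι-select : ∀ x α → ι x α ≡ select (toBits x) α
ι-select vF  α = refl
ι-select vf  α = refl
ι-select vf2 α = refl
ι-select vf3 α = refl
ι-select vt3 α = refl
ι-select vt2 α = refl
ι-select vt  α = refl
ι-select vT  α = refl

fromBits-∈-botT : b ≡ false → c ≡ true → fromBits (a , b , c) ∈ botT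
fromBits-∈-botT {a = false} refl refl = here refl
fromBits-∈-botT {a = true}  refl refl = there (here refl)

fromBits-∈-f2t2 : a ≡ true → c ≡ true → fromBits (a , b , c) ∈ (vf2 ∷ vt2 ∷ [])
fromBits-∈-f2t2 {b = false} refl refl = here refl
fromBits-∈-f2t2 {b = true}  refl refl = there (here refl)

fromBits-∈-Tt2 : a ≡ true → b ≡ true → fromBits (a , b , c) ∈ (vT ∷ vt2 ∷ [])
fromBits-∈-Tt2 {c = false} refl refl = here refl
fromBits-∈-Tt2 {c = true}  refl refl = there (here refl)

∀-bits? : ∀ {n} {P : Vec Bool n → Set} → Pred.Decidable P → Dec (∀ bs → P bs)
∀-bits? {zero}  P? = map′ (λ p → λ { [] → p }) (λ ∀P → ∀P []) (P? [])
∀-bits? {suc n} P? = map′ (λ (p , q) → λ { (true ∷ bs) → p bs ; (false ∷ bs) → q bs })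
                          (λ ∀P → ∀P ∘ (true ∷_) , ∀P ∘ (false ∷_))
                          (∀-bits? (P? ∘ (true ∷_)) ×-dec ∀-bits? (P? ∘ (false ∷_)))

-- From-yes reduces only when the decision evaluates to yes, so the type checker runs the check.
by-exhaustion : ∀ {n} {P : Vec Bool n → Set} (P? : Pred.Decidable P) → From-yes (∀-bits? P?)
by-exhaustion P? = from-yes (∀-bits? P?)

infixr 4 _⇒ᵇ_
_⇒ᵇ_ : Bool → Bool → Bool
a ⇒ᵇ b = not a ∨ b

-- Constraints between derivability bits, each named after the formula it records (□¬a: □¬α is
-- derivable), that every maximal consistent set satisfies.
□⊥-facts : (□p □¬p □⊥ : Bool) → List Bool
□⊥-facts □p □¬p □⊥ = (□p ∧ □¬p ⇒ᵇ □⊥) ∷ (□⊥ ⇒ᵇ □p) ∷ (□⊥ ⇒ᵇ □¬p) ∷ []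

impFacts : Vec Bool 10 → List Bool
impFacts (□a ∷ a ∷ □¬a ∷ □b ∷ b ∷ □¬b ∷ □c ∷ c ∷ □¬c ∷ □⊥ ∷ []) =
  (c ∧ a ⇒ᵇ b) ∷ (not a ⇒ᵇ c) ∷ (b ⇒ᵇ c) ∷
  (□¬a ⇒ᵇ □c) ∷ (□b ⇒ᵇ □c) ∷ (□a ∧ □c ⇒ᵇ □b) ∷
  (□¬c ⇒ᵇ □a) ∷ (□¬c ⇒ᵇ □¬b) ∷ (□a ∧ □¬b ⇒ᵇ □¬c) ∷ (□c ∧ □¬b ⇒ᵇ □¬a) ∷
  □⊥-facts □a □¬a □⊥ ++ □⊥-facts □b □¬b □⊥ ++ □⊥-facts □c □¬c □⊥

ImpRespected : Vec Bool 10 → Set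
ImpRespected (□a ∷ a ∷ □¬a ∷ □b ∷ b ∷ □¬b ∷ □c ∷ c ∷ □¬c ∷ _) =
  fromBits (□c , c , □¬c) ∈ impT (fromBits (□a , a , □¬a)) (fromBits (□b , b , □¬b))

impRespected? : Pred.Decidable ImpRespected
impRespected? (_ ∷ _ ∷ _ ∷ _ ∷ _ ∷ _ ∷ _ ∷ _ ∷ _ ∷ _) = _ ∈? _

impT-respected : ∀ bs → All T (impFacts bs) → ImpRespected bs
impT-respected = by-exhaustion λ bs → all? T? (impFacts bs) →-dec impRespected? bs

boxFacts : Logic → Vec Bool 8 → List Bool
boxFacts L (□a ∷ a ∷ □¬a ∷ □□a ∷ □¬□a ∷ □□¬a ∷ □¬□¬a ∷ □⊥ ∷ []) =
  (hasD L ⇒ᵇ not □⊥) ∷ (hasD L ⇒ᵇ □□¬a ⇒ᵇ □¬□a) ∷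
  (hasT L ⇒ᵇ □a ⇒ᵇ a) ∷ (hasT L ⇒ᵇ □¬a ⇒ᵇ not a) ∷ (hasT L ⇒ᵇ □□a ⇒ᵇ □a) ∷
  (hasT L ⇒ᵇ □¬□a ⇒ᵇ not □a) ∷ (hasT L ⇒ᵇ □¬a ⇒ᵇ □¬□a) ∷
  (hasB L ⇒ᵇ not a ⇒ᵇ □¬□a) ∷ (hasB L ⇒ᵇ a ⇒ᵇ □¬□¬a) ∷
  (has4 L ⇒ᵇ □a ⇒ᵇ □□a) ∷ (has4 L ⇒ᵇ □¬a ⇒ᵇ □□¬a) ∷
  (has5 L ⇒ᵇ not □a ⇒ᵇ □¬□a) ∷ (has5 L ⇒ᵇ not □□a ⇒ᵇ □¬□a) ∷
  □⊥-facts □a □¬a □⊥ ++ □⊥-facts □□a □¬□a □⊥ ++ □⊥-facts □□¬a □¬□¬a □⊥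

BoxRespected : Logic → Vec Bool 8 → Set
BoxRespected L (□a ∷ a ∷ □¬a ∷ □□a ∷ □¬□a ∷ _) =
  fromBits (□a , a , □¬a) ∈ values L × fromBits (□□a , □a , □¬□a) ∈ boxT L (fromBits (□a , a , □¬a))

boxRespected? : ∀ L → Pred.Decidable (BoxRespected L)
boxRespected? L (_ ∷ _ ∷ _ ∷ _ ∷ _ ∷ _) = (_ ∈? _) ×-dec (_ ∈? _)

boxCheck? : ∀ L → Pred.Decidable λ bs → All T (boxFacts L bs) → BoxRespected L bs
boxCheck? L bs = all? T? (boxFacts L bs) →-dec boxRespected? L bs

-- One clause per logic: the check only evaluates for a concrete L.
boxT-respected : ∀ L bs → All T (boxFacts L bs) → BoxRespected L bs
boxT-respected K    = by-exhaustion (boxCheck? K)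
boxT-respected KB   = by-exhaustion (boxCheck? KB)
boxT-respected K4   = by-exhaustion (boxCheck? K4)
boxT-respected K5   = by-exhaustion (boxCheck? K5)
boxT-respected K45  = by-exhaustion (boxCheck? K45)
boxT-respected KD   = by-exhaustion (boxCheck? KD)
boxT-respected KDB  = by-exhaustion (boxCheck? KDB)
boxT-respected KD4  = by-exhaustion (boxCheck? KD4)
boxT-respected KD5  = by-exhaustion (boxCheck? KD5)
boxT-respected KD45 = by-exhaustion (boxCheck? KD45)
boxT-respected KT   = by-exhaustion (boxCheck? KT)
boxT-respected KTB  = by-exhaustion (boxCheck? KTB)
boxT-respected S4   = by-exhaustion (boxCheck? S4)
boxT-respected S5   = by-exhaustion (boxCheck? S5)
boxT-respected KB5  = by-exhaustion (boxCheck? KB5)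

module Canonical (em : ExcludedMiddle 0ℓ) (L : Logic) (Δ : FSet) where
  open Deduction L

  ⊢? : ∀ φ → Dec (Δ ⊢ φ)
  ⊢? φ = em

  ⟦_⟧ : Form → Bool
  ⟦ φ ⟧ = does (⊢? φ)

  bits : Form → Bits
  bits α = ⟦ □ α ⟧ , ⟦ α ⟧ , ⟦ □ (~ α) ⟧

  characteristic : Form → V8
  characteristic = fromBits ∘ bits

  impBits : Form → Form → Vec Bool 10
  impBits α β = ⟦ □ α ⟧ ∷ ⟦ α ⟧ ∷ ⟦ □ (~ α) ⟧ ∷ ⟦ □ β ⟧ ∷ ⟦ β ⟧ ∷ ⟦ □ (~ β) ⟧
              ∷ ⟦ □ γ ⟧ ∷ ⟦ γ ⟧ ∷ ⟦ □ (~ γ) ⟧ ∷ ⟦ □ ⊥' ⟧ ∷ []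
    where γ = α ⇒ β

  boxBits : Form → Vec Bool 8
  boxBits α = ⟦ □ α ⟧ ∷ ⟦ α ⟧ ∷ ⟦ □ (~ α) ⟧ ∷ ⟦ □ (□ α) ⟧ ∷ ⟦ □ (~ □ α) ⟧
            ∷ ⟦ □ (□ (~ α)) ⟧ ∷ ⟦ □ (~ □ (~ α)) ⟧ ∷ ⟦ □ ⊥' ⟧ ∷ []

  ⊢-if : Δ ⊢ ψ ⇔ (¬ Δ ⊢ φ) → ∀ b → Δ ⊢ (if b then φ else ψ) ⇔ ⟦ φ ⟧ ≡ b
  ⊢-if {φ = φ} _      true  = ⇔-sym (does≡⇔ (⊢? φ))
  ⊢-if {φ = φ} ψ⇔⊬φ false = ⇔-trans ψ⇔⊬φ (⇔-sym (does≡⇔ (⊢? φ)))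

  theorem⇒T-or-t2 : Thm L α → characteristic α ∈ (vT ∷ vt2 ∷ [])
  theorem⇒T-or-t2 t =
    fromBits-∈-Tt2 (dec-true (⊢? _) (⊢-theorem (nec t))) (dec-true (⊢? _) (⊢-theorem t))

  □⊥-facts-hold : ∀ φ → All T (□⊥-facts ⟦ □ φ ⟧ ⟦ □ (~ φ) ⟧ ⟦ □ ⊥' ⟧)
  □⊥-facts-hold φ =
      T-does ((⊢? (□ φ) ×-dec ⊢? (□ (~ φ))) →-dec ⊢? (□ ⊥')) (uncurry (⊢-□map₂ (#1 · #0)))
    ∷ T-does (⊢? (□ ⊥') →-dec ⊢? (□ φ)) (⊢-□map₁ (efq #0))
    ∷ T-does (⊢? (□ ⊥') →-dec ⊢? (□ (~ φ))) (⊢-□map₁ (efq #0))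
    ∷ []

  module _ (mc : MaxConsistent L Δ) where
    open MaximalConsistent em L mc

    ⊢-select : ∀ bs → Δ ⊢ select bs α ⇔ bits α ≡ bs
    ⊢-select (s , t , u) =
      ⇔-trans ⊢-∧ (⇔-trans (⊢-if ◇~⇔⊬□ s ×-⇔ ⇔-trans ⊢-∧ (⊢-if ⊢~⇔⊬ t ×-⇔ ⊢-if ⊢~⇔⊬ u)) ≡×≡×≡⇔≡)
      where
      ≡×≡×≡⇔≡ : ∀ {a b c} → (a ≡ s × b ≡ t × c ≡ u) ⇔ (a , b , c) ≡ (s , t , u)
      ≡×≡×≡⇔≡ = mk⇔ (λ { (refl , refl , refl) → refl }) (λ { refl → refl , refl , refl })

    isCharacteristic : IsCharacteristic L Δ characteristic
    isCharacteristic α x = begin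
      characteristic α ≡ x     ≈⟨ fromBits≡⇔ ⟩
      bits α ≡ toBits x        ≈⟨ ⊢-select (toBits x) ⟨
      Δ ⊢ select (toBits x) α ≡⟨ cong (Δ ⊢_) (ι-select x α) ⟨
      Δ ⊢ ι x α                ≈⟨ ⊢⇔⊢[] ⟩
      Δ ⊢[ L ] ι x α           ∎
      where open import Relation.Binary.Reasoning.Setoid (⇔-setoid 0ℓ)

    ⊢-ι-characteristic : ∀ α → Δ ⊢ ι (characteristic α) α
    ⊢-ι-characteristic α = ⊢⇔⊢[] .from (isCharacteristic α _ .to refl)

    designated⇒⊢ : characteristic α ∈ designated → Δ ⊢ α
    designated⇒⊢ {α} m = ⊢-ι-designated m (⊢-ι-characteristic α)

    -- Negative introspection ¬□φ → □¬□φ, used for φ = ¬□α and, under the box, for φ = α.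
    ¬□□⇒□~□ : T (has5 L) → ¬ Δ ⊢ □ (□ α) → Δ ⊢ □ (~ □ α)
    ¬□□⇒□~□ f ⊬□□α = decidable-stable (⊢? _) λ ⊬□~□α →
      ⊬□□α (⊢-□map₁ (by-contradiction (#1 · (thm (~□⇒□~□ f) · #0)))
                    (⊢-mp (⊢-theorem (~□⇒□~□ f)) (⊢~⇔⊬ .from ⊬□~□α)))

    impFacts-hold : ∀ α β → All T (impFacts (impBits α β))
    impFacts-hold α β =
        T-does ((⊢? γ ×-dec ⊢? α) →-dec ⊢? β) (uncurry ⊢-mp)
      ∷ T-does (¬? (⊢? α) →-dec ⊢? γ) (λ ⊬α → ⊢-map (ƛ efq (#1 · #0)) (⊢~⇔⊬ .from ⊬α ∷ []))
      ∷ T-does (⊢? β →-dec ⊢? γ) (⊢-mp (⊢-theorem (ax1 β α)))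
      ∷ T-does (⊢? (□ (~ α)) →-dec ⊢? (□ γ)) (⊢-□map₁ (ƛ efq (#1 · #0)))
      ∷ T-does (⊢? (□ β) →-dec ⊢? (□ γ)) (⊢-□map₁ (ƛ #1))
      ∷ T-does ((⊢? (□ α) ×-dec ⊢? (□ γ)) →-dec ⊢? (□ β)) (uncurry (⊢-□map₂ (#1 · #0)))
      ∷ T-does (⊢? (□ (~ γ)) →-dec ⊢? (□ α)) (⊢-□map₁ (by-contradiction (#1 · (ƛ efq (#1 · #0)))))
      ∷ T-does (⊢? (□ (~ γ)) →-dec ⊢? (□ (~ β))) (⊢-□map₁ (ƛ (#1 · (ƛ #1))))
      ∷ T-does ((⊢? (□ α) ×-dec ⊢? (□ (~ β))) →-dec ⊢? (□ (~ γ)))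
          (uncurry (⊢-□map₂ (ƛ (#2 · (#0 · #1)))))
      ∷ T-does ((⊢? (□ γ) ×-dec ⊢? (□ (~ β))) →-dec ⊢? (□ (~ α)))
          (uncurry (⊢-□map₂ (ƛ (#2 · (#1 · #0)))))
      ∷ ++⁺ (□⊥-facts-hold α) (++⁺ (□⊥-facts-hold β) (□⊥-facts-hold γ))
      where γ = α ⇒ β

    boxFacts-hold : ∀ α → All T (boxFacts L (boxBits α))
    boxFacts-hold α =
        T-does (T? (hasD L) →-dec ¬? (⊢? (□ ⊥')))
          (λ d → ⊢~⇔⊬ .to (⊢-mp (⊢-theorem (□~⇒~□ d)) (⊢-theorem (nec ⇒-refl))))
      ∷ T-does (T? (hasD L) →-dec ⊢? (□ (□ (~ α))) →-dec ⊢? (□ (~ □ α)))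
          (λ d → ⊢-□map₁ (thm (□~⇒~□ d) · #0))
      ∷ T-does (T? (hasT L) →-dec ⊢? (□ α) →-dec ⊢? α)
          (λ t → ⊢-mp (⊢-theorem (axT t α)))
      ∷ T-does (T? (hasT L) →-dec ⊢? (□ (~ α)) →-dec ¬? (⊢? α))
          (λ t → ⊢~⇔⊬ .to ∘ ⊢-mp (⊢-theorem (axT t (~ α))))
      ∷ T-does (T? (hasT L) →-dec ⊢? (□ (□ α)) →-dec ⊢? (□ α))
          (λ t → ⊢-mp (⊢-theorem (axT t (□ α))))
      ∷ T-does (T? (hasT L) →-dec ⊢? (□ (~ □ α)) →-dec ¬? (⊢? (□ α)))
          (λ t → ⊢~⇔⊬ .to ∘ ⊢-mp (⊢-theorem (axT t (~ □ α))))
      ∷ T-does (T? (hasT L) →-dec ⊢? (□ (~ α)) →-dec ⊢? (□ (~ □ α)))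
          (λ t → ⊢-□map₁ (ƛ (#1 · (thm (axT t α) · #0))))
      ∷ T-does (T? (hasB L) →-dec ¬? (⊢? α) →-dec ⊢? (□ (~ □ α)))
          (λ b → ⊢-□map₁ (thm ◇~⇒~□ · #0) ∘ ⊢-mp (⊢-theorem (axB b (~ α))) ∘ ⊢~⇔⊬ .from)
      ∷ T-does (T? (hasB L) →-dec ⊢? α →-dec ⊢? (□ (~ □ (~ α))))
          (λ b → ⊢-mp (⊢-theorem (axB b α)))
      ∷ T-does (T? (has4 L) →-dec ⊢? (□ α) →-dec ⊢? (□ (□ α)))
          (λ f → ⊢-mp (⊢-theorem (ax4 f α)))
      ∷ T-does (T? (has4 L) →-dec ⊢? (□ (~ α)) →-dec ⊢? (□ (□ (~ α))))
          (λ f → ⊢-mp (⊢-theorem (ax4 f (~ α))))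
      ∷ T-does (T? (has5 L) →-dec ¬? (⊢? (□ α)) →-dec ⊢? (□ (~ □ α)))
          (λ f → ⊢-mp (⊢-theorem (~□⇒□~□ f)) ∘ ⊢~⇔⊬ .from)
      ∷ T-does (T? (has5 L) →-dec ¬? (⊢? (□ (□ α))) →-dec ⊢? (□ (~ □ α)))
          ¬□□⇒□~□
      ∷ ++⁺ (□⊥-facts-hold α) (++⁺ (□⊥-facts-hold (□ α)) (□⊥-facts-hold (□ (~ α))))

    characteristic-valuation : Valuation L characteristic
    characteristic-valuation =
        (λ α → proj₁ (box-respected α))
      , fromBits-∈-botT (dec-false (⊢? ⊥') ⊬⊥) (dec-true (⊢? (□ (~ ⊥'))) (⊢-theorem (nec ⇒-refl)))
      , (λ α β → impT-respected (impBits α β) (impFacts-hold α β))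
      , (λ α → proj₂ (box-respected α))
      where
      box-respected : ∀ α → BoxRespected L (boxBits α)
      box-respected α = boxT-respected L (boxBits α) (boxFacts-hold α)

    characteristic-level₀ : ∀ α → characteristic α ∈ (vf2 ∷ vt2 ∷ []) →
                            ∀ β → characteristic β ∈ (vf2 ∷ vt2 ∷ [])
    characteristic-level₀ α m β =
      fromBits-∈-f2t2 (dec-true (⊢? _) (⊢-□map₁ (efq #0) ⊢□⊥)) (dec-true (⊢? _) (⊢-□map₁ (efq #0) ⊢□⊥))
      where
      ⊢□⊥ : Δ ⊢ □ ⊥'
      ⊢□⊥ = ⊢-ι-f2t2 m (⊢-ι-characteristic α)

module Completeness (em : ExcludedMiddle 0ℓ) (L : Logic) where
  open Lindenbaum em L using (lindenbaum)
  open Canonical em L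

  valid⇒theorem : (W : (Form → V8) → Set) → (∀ {Δ} → MaxConsistent L Δ → W (characteristic Δ)) →
                  (∀ w → W w → w α ∈ designated) → Thm L α
  valid⇒theorem W canonical∈W valid = decidable-stable em λ ⊬α →
    let Δ , mc , ⊢~α = lindenbaum ⊬α in
    MaximalConsistent.⊢~⇔⊬ em L mc .to ⊢~α (designated⇒⊢ Δ mc (valid _ (canonical∈W mc)))

  characteristic-level : ∀ n {Δ} → MaxConsistent L Δ → InLevel L n (characteristic Δ)
  characteristic-level zero    {Δ} mc = characteristic-valuation Δ mc , characteristic-level₀ Δ mc
  characteristic-level (suc n) {Δ} mc = characteristic-level n mc , λ α valid →
    theorem⇒T-or-t2 Δ (valid⇒theorem (InLevel L n) (characteristic-level n) valid)

lemma3 : ExcludedMiddle 0ℓ →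
    (L : Logic) (Δ : FSet) → MaxConsistent L Δ →
    Σ (Form → V8) (λ v → IsCharacteristic L Δ v × ((n : ℕ) → InLevel L n v))
lemma3 em L Δ mc = characteristic Δ , isCharacteristic Δ mc , λ n → characteristic-level n mc
  where
  open Canonical em L
  open Completeness em L
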